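{- Let $G$ be a graph of order $n\ge 2$ and $p$ an integer with $1\le p\le \frac{n}{2}-1$. If $G$ has a subgraph isomorphic to the path $P_n$, then $$\gamma_t(M(G+\overline{K_p}))=\left\lceil\frac{2(n+p)}{3}\right\rceil.$$
   Context: All graphs are finite and simple. $P_n$ is the path on $n$ vertices and $\overline{K_p}$ the edgeless graph on $p$ vertices. The join $G+H$ of graphs $G,H$ (on disjoint vertex sets) has vertex set $V(G)\cup V(H)$ and edge set $E(G)\cup E(H)\cup\{vw : v\in V(G), w\in V(H)\}$. For a graph $H$ with no isolated vertices, a total dominating set of $H$ is a set $S\subseteq V(H)$ such that every vertex of $H$ has at least one neighbor in $S$; $\gamma_t(H)$ is the minimum cardinality of a total dominating set. The middle graph $M(G)$ of a graph $G$ has vertex set $V(G)\cup E(G)$ (disjoint union), and two of its vertices $x,y$ are adjacent exactly when either $x,y\in E(G)$ are edges of $G$ sharing a common endpoint, or $x\in V(G)$, $y\in E(G)$ and $x$ is an endpoint of $y$ (no two elements of $V(G)$ are adjacent in $M(G)$). -}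

module Defs where

open import Data.Bool using (Bool; true; false; _∨_; _∧_)
open import Data.Nat using (ℕ; suc; _+_; _≤_)
open import Data.Fin using (Fin; toℕ; splitAt; _<_)
open import Data.Sum using (_⊎_; inj₁; inj₂)
open import Data.Product using (Σ; _×_; ∃-syntax)
open import Data.List using (List; length)
open import Data.List.Relation.Unary.Any using (Any)
open import Data.List.Relation.Unary.Unique.Propositional using (Unique)
open import Relation.Binary.PropositionalEquality using (_≡_)
open import Function.Definitions using (Injective)

AdjMat : ℕ → Set
AdjMat m = Fin m → Fin m → Bool

record IsSimple {m : ℕ} (A : AdjMat m) : Set where
  field
    sym     : ∀ u v → A u v ≡ true → A v u ≡ true
    irrefl  : ∀ u → A u u ≡ false

-- Join G + complement(K_p): vertices 0..n-1 are those of G, n..n+p-1 those of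
-- the edgeless graph on p vertices.
join-Kbar : {n : ℕ} → AdjMat n → (p : ℕ) → AdjMat (n + p)
join-Kbar {n} A p u v with splitAt n u | splitAt n v
... | inj₁ x | inj₁ y = A x y
... | inj₁ _ | inj₂ _ = true
... | inj₂ _ | inj₁ _ = true
... | inj₂ _ | inj₂ _ = false

-- Edges of a graph on Fin m: pairs u < v with u adjacent to v (each edge once).
Edge : {m : ℕ} → AdjMat m → Set
Edge {m} A = Σ (Fin m) λ u → Σ (Fin m) λ v → (u < v) × (A u v ≡ true)

IsEnd : {m : ℕ} {A : AdjMat m} → Fin m → Edge A → Set
IsEnd x (u Data.Product., v Data.Product., _) = (x ≡ u) ⊎ (x ≡ v)

MVertex : {m : ℕ} → AdjMat m → Set
MVertex {m} A = Fin m ⊎ Edge A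

MAdj : {m : ℕ} (A : AdjMat m) → MVertex A → MVertex A → Set
MAdj A (inj₁ _) (inj₁ _) = Data.Empty.⊥
  where import Data.Empty
MAdj A (inj₁ x) (inj₂ e) = IsEnd x e
MAdj A (inj₂ e) (inj₁ x) = IsEnd x e
MAdj {m} A (inj₂ e) (inj₂ f) = (¬ (e ≡ f)) × (∃[ x ] (IsEnd x e × IsEnd x f))
  where open import Relation.Nullary using (¬_)

IsTDS : {V : Set} → (V → V → Set) → List V → Set
IsTDS {V} R S = Unique S × (∀ (x : V) → Any (λ s → R x s) S)

TotalDominationNumber : {V : Set} → (V → V → Set) → ℕ → Set
TotalDominationNumber R k =
  (∃[ S ] (IsTDS R S × length S ≡ k)) × (∀ S → IsTDS R S → k ≤ length S)

-- G (on Fin n) has a spanning subgraph isomorphic to P_n (a Hamiltonian path).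
HasSpanningPath : {n : ℕ} → AdjMat n → Set
HasSpanningPath {n} A =
  ∃[ f ] (Injective _≡_ _≡_ f ×
          (∀ (i j : Fin n) → toℕ j ≡ suc (toℕ i) → A (f i) (f j) ≡ true))

-- In M(G) no two vertices of G are adjacent, so every vertex of G is dominated by an edge
-- of a total dominating set S. Charge each vertex x of G twice to the three slots of the
-- entries of S: once to slot 0 or 1 of the edge dominating it, according to which endpoint
-- x is, and once to slot 2 of that edge — unless both endpoints chose the same edge, in which
-- case the second endpoint charges the entry of S dominating that edge, through the vertex
-- they share. This injects two copies of V(G) into S × 3, so |S| ≥ ⌈2|V(G)|/3⌉.
--
-- Conversely, since p ≤ n the join G + K̄_p has a spanning path, obtained by weaving the p
-- new vertices into the first 2p positions of a spanning path of G. For a spanning path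
-- v₀ … v_{N-1}, the edges v_{3j}v_{3j+1} and v_{3j+1}v_{3j+2} together with the last two
-- edges of the path form a total dominating set of M of size ⌈2N/3⌉.
module Submission where

open import Defs
open import Axiom.UniquenessOfIdentityProofs using (module Decidable⇒UIP)
open import Data.Bool using (Bool; true; false)
import Data.Bool.Properties as Bool
open import Data.Empty using (⊥; ⊥-elim)
open import Data.Fin using (Fin; zero; suc; toℕ; inject₁; punchOut; splitAt; join; combine; cast; _↑ˡ_; _↑ʳ_)
open import Data.Fin.Properties as Fin
  using ( _≟_; <-cmp; any?; suc-injective; toℕ-injective; toℕ-inject₁; toℕ-cast; ↑ʳ-injective
        ; splitAt-join; splitAt-↑ˡ; splitAt-↑ʳ; +↔⊎; combine-injective; punchOut-injective; injective⇒≤ )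
open import Data.List using (List; []; _∷_; map; length; lookup)
open import Data.List.Properties using (length-map)
open import Data.List.Membership.Propositional using (_∈_; lose)
open import Data.List.Membership.Propositional.Properties using (∈-map⁺; ∈-map⁻)
open import Data.List.Relation.Unary.All using (All; _∷_; universal)
import Data.List.Relation.Unary.All.Properties as All
open import Data.List.Relation.Unary.AllPairs using (_∷_)
open import Data.List.Relation.Unary.Any using (Any; here; there; index)
open import Data.List.Relation.Unary.Any.Properties using (lookup-index)
open import Data.List.Relation.Unary.Unique.Propositional using (Unique)
import Data.List.Relation.Unary.Unique.Propositional.Properties as Unique
import Data.List.Relation.Unary.Unique.DecPropositional as DecUnique
open import Data.Nat using (ℕ; _+_; _*_; _≤_; _/_; z≤n; s≤s)
import Data.Nat.Base as ℕ using (zero; suc)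
import Data.Nat.Properties as ℕ
open import Data.Nat.DivMod using (+-distrib-/-∣ˡ; +-distrib-/-∣ʳ; /-monoˡ-≤; m*n/n≡m)
open import Data.Nat.Divisibility using (divides-refl)
open import Data.Nat.Tactic.RingSolver using (solve-∀)
open import Data.Product using (_×_; _,_; proj₁; proj₂; ∃-syntax; uncurry)
open import Data.Product.Properties using (≡-dec; ,-injective; ×-≡,≡→≡)
open import Data.Sum using (_⊎_; inj₁; inj₂)
import Data.Sum as Sum
open import Data.Sum.Properties using (inj₁-injective; inj₂-injective)
open import Data.Unit using (⊤; tt)
open import Function using (_∘_)
open import Function.Bundles using (Injection)
open import Function.Definitions using (Injective)
open import Function.Properties.Inverse using (↔⇒↣)
open import Relation.Binary.Definitions using (DecidableEquality; tri<; tri≈; tri>)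
open import Relation.Binary.PropositionalEquality
open import Relation.Nullary using (¬_; yes; no; contradiction; _×-dec_)
open import Relation.Nullary.Decidable using (from-yes)
open import Relation.Unary using (Decidable)

endo-injective⇒surjective : ∀ {n} {f : Fin n → Fin n} → Injective _≡_ _≡_ f → ∀ y → ∃[ x ] f x ≡ y
endo-injective⇒surjective {ℕ.suc n} {f} f-injective y with any? (λ x → f x ≟ y)
... | yes found = found
... | no ¬found = contradiction (injective⇒≤ {f = avoid} avoid-injective) ℕ.1+n≰n
  where
    y≢f : ∀ x → y ≢ f x
    y≢f x y≡fx = ¬found (x , sym y≡fx)
    avoid : Fin (ℕ.suc n) → Fin n
    avoid x = punchOut (y≢f x)
    avoid-injective : Injective _≡_ _≡_ avoid
    avoid-injective {x} {x′} eq = f-injective (punchOut-injective (y≢f x) (y≢f x′) eq)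

|⊎|≤|×| : ∀ {a b c d} (f : Fin a ⊎ Fin b → Fin c × Fin d) → Injective _≡_ _≡_ f → a + b ≤ c * d
|⊎|≤|×| {a} f f-injective = injective⇒≤ {f = uncurry combine ∘ f ∘ splitAt a} λ eq →
  Injection.injective (↔⇒↣ +↔⊎) (f-injective (×-≡,≡→≡ (combine-injective _ _ _ _ eq)))

m+m≤n*3⇒[2m+2]/3≤n : ∀ m n → m + m ≤ n * 3 → (2 * m + 2) / 3 ≤ n
m+m≤n*3⇒[2m+2]/3≤n m n m+m≤n*3 = begin
  (2 * m + 2) / 3  ≤⟨ /-monoˡ-≤ 3 (ℕ.+-monoˡ-≤ 2 2m≤n*3) ⟩
  (n * 3 + 2) / 3  ≡⟨ +-distrib-/-∣ˡ 2 (divides-refl n) ⟩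
  n * 3 / 3 + 0    ≡⟨ ℕ.+-identityʳ _ ⟩
  n * 3 / 3        ≡⟨ m*n/n≡m n 3 ⟩
  n                ∎
  where
    open ℕ.≤-Reasoning
    2m≤n*3 : 2 * m ≤ n * 3
    2m≤n*3 = subst (_≤ n * 3) (cong (m +_) (sym (ℕ.+-identityʳ m))) m+m≤n*3

module _ {m : ℕ} {A : AdjMat m} where

  endpoint : Edge A → Bool → Fin m
  endpoint (u , _ , _ , _) false = u
  endpoint (_ , v , _ , _) true  = v

  IsEnd⇒endpoint : ∀ {x} e → IsEnd x e → ∃[ c ] endpoint e c ≡ x
  IsEnd⇒endpoint _ (inj₁ refl) = false , refl
  IsEnd⇒endpoint _ (inj₂ refl) = true , refl

  -- Where an element of M(A) can meet an edge of A: a vertex of A at itself (either side),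
  -- an edge at either endpoint.
  anchor : MVertex A → Bool → Fin m
  anchor (inj₁ w) _ = w
  anchor (inj₂ e) c = endpoint e c

  vertex-neighbour : ∀ {x y} → MAdj A (inj₁ x) y → ∃[ e ] (y ≡ inj₂ e × IsEnd x e)
  vertex-neighbour {y = inj₂ e} x∈e = e , refl , x∈e

  edge-neighbour : ∀ {e y} → MAdj A (inj₂ e) y →
                   ∃[ c ] (IsEnd (anchor y c) e × y ≢ inj₂ e)
  edge-neighbour {y = inj₁ w} w∈e = false , w∈e , λ ()
  edge-neighbour {e} {inj₂ f} (e≢f , w , w∈e , w∈f) with IsEnd⇒endpoint f w∈f
  ... | c , refl = c , w∈e , e≢f ∘ sym ∘ inj₂-injective

  edge-≟ : DecidableEquality (Edge A)
  edge-≟ = ≡-dec _≟_ (≡-dec _≟_ (≡-dec (λ p q → yes (Fin.<-irrelevant p q))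
                                       (λ p q → yes (Decidable⇒UIP.≡-irrelevant Bool._≟_ p q))))

  record Joins (e : Edge A) (u v : Fin m) : Set where
    field
      first  : IsEnd u e
      second : IsEnd v e
      only   : ∀ {x} → IsEnd x e → x ≡ u ⊎ x ≡ v

  edgeBetween : IsSimple A → ∀ {u v} → A u v ≡ true → ∃[ e ] Joins e u v
  edgeBetween simple {u} {v} uv with <-cmp u v
  ... | tri< u<v _ _ = (u , v , u<v , uv) ,
                       record { first = inj₁ refl ; second = inj₂ refl ; only = λ x∈ → x∈ }
  ... | tri≈ _ refl _ = contradiction (trans (sym uv) (IsSimple.irrefl simple u)) λ ()
  ... | tri> _ _ v<u = (v , u , v<u , IsSimple.sym simple u v uv) ,
                       record { first = inj₂ refl ; second = inj₁ refl ; only = Sum.swap }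

module TotalDominationLowerBound {m : ℕ} (A : AdjMat m) (S : List (MVertex A))
                                 (dominated : ∀ x → Any (MAdj A x) S) where

  Slot : Set
  Slot = Fin (length S) × Fin 3

  slotVertex : Fin (length S) → Bool → Fin m
  slotVertex i = anchor (lookup S i)

  coverIndex : Fin m → Fin (length S)
  coverIndex x = index (dominated (inj₁ x))

  incidentCoverEdge : ∀ x → ∃[ e ] (lookup S (coverIndex x) ≡ inj₂ e × IsEnd x e)
  incidentCoverEdge x = vertex-neighbour (lookup-index (dominated (inj₁ x)))

  coverEdge : Fin m → Edge A
  coverEdge x = proj₁ (incidentCoverEdge x)

  lookup-coverIndex : ∀ x → lookup S (coverIndex x) ≡ inj₂ (coverEdge x)
  lookup-coverIndex x = proj₁ (proj₂ (incidentCoverEdge x))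

  coverSide : Fin m → Bool
  coverSide x = proj₁ (IsEnd⇒endpoint (coverEdge x) (proj₂ (proj₂ (incidentCoverEdge x))))

  endpoint-coverSide : ∀ x → endpoint (coverEdge x) (coverSide x) ≡ x
  endpoint-coverSide x = proj₂ (IsEnd⇒endpoint (coverEdge x) (proj₂ (proj₂ (incidentCoverEdge x))))

  slotVertex-cover : ∀ x → slotVertex (coverIndex x) (coverSide x) ≡ x
  slotVertex-cover x =
    trans (cong (λ v → anchor v (coverSide x)) (lookup-coverIndex x)) (endpoint-coverSide x)

  coverEdge-cong : ∀ {x y} → coverIndex x ≡ coverIndex y → coverEdge x ≡ coverEdge y
  coverEdge-cong {x} {y} eq =
    inj₂-injective (trans (sym (lookup-coverIndex x)) (trans (cong (lookup S) eq) (lookup-coverIndex y)))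

  cover-injective : ∀ {x y} → coverIndex x ≡ coverIndex y → coverSide x ≡ coverSide y → x ≡ y
  cover-injective {x} {y} i≡ c≡ =
    trans (sym (slotVertex-cover x)) (trans (cong₂ slotVertex i≡ c≡) (slotVertex-cover y))

  -- Both endpoints of the covering edge of x are covered by the same entry of S, and x is
  -- the second one: the third slot of that entry is then left to the first endpoint.
  Doubled : Fin m → Set
  Doubled x = coverSide x ≡ true × coverIndex (endpoint (coverEdge x) false) ≡ coverIndex x

  doubled? : Decidable Doubled
  doubled? x = coverSide x Bool.≟ true ×-dec coverIndex (endpoint (coverEdge x) false) ≟ coverIndex x

  doubled-coverIndex : ∀ {x w} → Doubled x → IsEnd w (coverEdge x) → coverIndex w ≡ coverIndex x
  doubled-coverIndex {x} (side≡true , first≡) w∈e with IsEnd⇒endpoint (coverEdge x) w∈e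
  ... | false , refl = first≡
  ... | true , refl =
    cong coverIndex (trans (cong (endpoint (coverEdge x)) (sym side≡true)) (endpoint-coverSide x))

  second-endpoint-doubled : ∀ {x y} → coverIndex x ≡ coverIndex y →
                            coverSide x ≡ false → coverSide y ≡ true → Doubled y
  second-endpoint-doubled {x} {y} i≡ x-first y-second = y-second , (begin
    coverIndex (endpoint (coverEdge y) false)
      ≡⟨ cong (λ e → coverIndex (endpoint e false)) (coverEdge-cong i≡) ⟨
    coverIndex (endpoint (coverEdge x) false)
      ≡⟨ cong (coverIndex ∘ endpoint (coverEdge x)) x-first ⟨
    coverIndex (endpoint (coverEdge x) (coverSide x))
      ≡⟨ cong coverIndex (endpoint-coverSide x) ⟩
    coverIndex x
      ≡⟨ i≡ ⟩
    coverIndex y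
      ∎)
    where open ≡-Reasoning

  record EdgeDominator (e : Edge A) : Set where
    field
      position : Fin (length S)
      side     : Bool
      meets    : IsEnd (slotVertex position side) e
      distinct : lookup S position ≢ inj₂ e

  edgeDominator : ∀ e → EdgeDominator e
  edgeDominator e with edge-neighbour (lookup-index (dominated (inj₂ e)))
  ... | c , w∈e , distinct = record { position = index (dominated (inj₂ e)) ; side = c
                                    ; meets = w∈e ; distinct = distinct }

  sideSlot : Bool → Fin 3
  sideSlot false = zero
  sideSlot true  = suc zero

  sideSlot-injective : ∀ {c c'} → sideSlot c ≡ sideSlot c' → c ≡ c'
  sideSlot-injective {false} {false} _ = refl
  sideSlot-injective {true}  {true}  _ = refl

  sideSlot≢2 : ∀ c → sideSlot c ≢ suc (suc zero)
  sideSlot≢2 false ()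
  sideSlot≢2 true ()

  dominatorSlot : Edge A → Slot
  dominatorSlot e = EdgeDominator.position (edgeDominator e) , sideSlot (EdgeDominator.side (edgeDominator e))

  firstSlot : Fin m → Slot
  firstSlot x = coverIndex x , sideSlot (coverSide x)

  secondSlot : Fin m → Slot
  secondSlot x with doubled? x
  ... | yes _ = dominatorSlot (coverEdge x)
  ... | no _  = coverIndex x , suc (suc zero)

  slot : Fin m ⊎ Fin m → Slot
  slot (inj₁ x) = firstSlot x
  slot (inj₂ x) = secondSlot x

  firstSlot-injective : ∀ {x y} → firstSlot x ≡ firstSlot y → x ≡ y
  firstSlot-injective eq with ,-injective eq
  ... | i≡ , s≡ = cover-injective i≡ (sideSlot-injective s≡)

  dominatorSlot-vertex : ∀ {x i c} → dominatorSlot (coverEdge x) ≡ (i , sideSlot c) →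
                        IsEnd (slotVertex i c) (coverEdge x)
  dominatorSlot-vertex {x} eq with ,-injective eq
  ... | refl , s≡ = subst (λ c → IsEnd (slotVertex _ c) (coverEdge x)) (sideSlot-injective s≡)
                          (EdgeDominator.meets (edgeDominator (coverEdge x)))

  dominatorSlot-injective : ∀ {x y} → Doubled x → Doubled y →
                           dominatorSlot (coverEdge x) ≡ dominatorSlot (coverEdge y) → x ≡ y
  dominatorSlot-injective {x} {y} dx dy eq = cover-injective
    (trans (sym (doubled-coverIndex dx (EdgeDominator.meets (edgeDominator (coverEdge x)))))
           (doubled-coverIndex dy (dominatorSlot-vertex (sym eq))))
    (trans (proj₁ dx) (sym (proj₁ dy)))

  firstSlot≢dominatorSlot : ∀ {x y} → Doubled y → firstSlot x ≢ dominatorSlot (coverEdge y)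
  firstSlot≢dominatorSlot {x} {y} dy eq with ,-injective eq
  ... | i≡ , _ = EdgeDominator.distinct (edgeDominator (coverEdge y)) (begin
    lookup S (EdgeDominator.position (edgeDominator (coverEdge y)))  ≡⟨ cong (lookup S) i≡ ⟨
    lookup S (coverIndex x)                                ≡⟨ lookup-coverIndex x ⟩
    inj₂ (coverEdge x)                                     ≡⟨ cong inj₂ (coverEdge-cong x≡y) ⟩
    inj₂ (coverEdge y)                                     ∎)
    where
      open ≡-Reasoning
      x∈e : IsEnd x (coverEdge y)
      x∈e = subst (λ v → IsEnd v (coverEdge y)) (slotVertex-cover x) (dominatorSlot-vertex (sym eq))
      x≡y : coverIndex x ≡ coverIndex y
      x≡y = doubled-coverIndex dy x∈e

  thirdSlot-injective : ∀ {x y} → ¬ Doubled x → ¬ Doubled y → coverIndex x ≡ coverIndex y → x ≡ y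
  thirdSlot-injective {x} {y} ¬dx ¬dy i≡ = bySides (coverSide x) refl (coverSide y) refl
    where
      bySides : ∀ a → coverSide x ≡ a → ∀ b → coverSide y ≡ b → x ≡ y
      bySides false sx false sy = cover-injective i≡ (trans sx (sym sy))
      bySides true  sx true  sy = cover-injective i≡ (trans sx (sym sy))
      bySides false sx true  sy = ⊥-elim (¬dy (second-endpoint-doubled i≡ sx sy))
      bySides true  sx false sy = ⊥-elim (¬dx (second-endpoint-doubled (sym i≡) sy sx))

  slot-injective : Injective _≡_ _≡_ slot
  slot-injective {inj₁ x} {inj₁ y} eq = cong inj₁ (firstSlot-injective eq)
  slot-injective {inj₁ x} {inj₂ y} eq with doubled? y
  ... | yes dy = ⊥-elim (firstSlot≢dominatorSlot dy eq)
  ... | no _   = ⊥-elim (sideSlot≢2 (coverSide x) (proj₂ (,-injective eq)))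
  slot-injective {inj₂ x} {inj₁ y} eq with doubled? x
  ... | yes dx = ⊥-elim (firstSlot≢dominatorSlot dx (sym eq))
  ... | no _   = ⊥-elim (sideSlot≢2 (coverSide y) (sym (proj₂ (,-injective eq))))
  slot-injective {inj₂ x} {inj₂ y} eq with doubled? x | doubled? y
  ... | yes dx | yes dy = cong inj₂ (dominatorSlot-injective dx dy eq)
  ... | yes _  | no _   = ⊥-elim (sideSlot≢2 _ (proj₂ (,-injective eq)))
  ... | no _   | yes _  = ⊥-elim (sideSlot≢2 _ (sym (proj₂ (,-injective eq))))
  ... | no ¬dx | no ¬dy = cong inj₂ (thirdSlot-injective ¬dx ¬dy (proj₁ (,-injective eq)))

  twice-order≤thrice-length : m + m ≤ length S * 3
  twice-order≤thrice-length = |⊎|≤|×| slot slot-injective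

length-middleTDS-≥ : ∀ {m} (A : AdjMat m) S → IsTDS (MAdj A) S → (2 * m + 2) / 3 ≤ length S
length-middleTDS-≥ {m} A S (_ , dominated) =
  m+m≤n*3⇒[2m+2]/3≤n m (length S) (TotalDominationLowerBound.twice-order≤thrice-length A S dominated)

-- Edges i, j of a path, where edge i joins vertices inject₁ i and suc i, share a vertex.
Consecutive : ∀ {k} → Fin k → Fin k → Set
Consecutive i j = suc i ≡ inject₁ j ⊎ inject₁ i ≡ suc j

toℕ-suc≡inject₁ : ∀ {k} {i j : Fin k} → suc i ≡ inject₁ j → ℕ.suc (toℕ i) ≡ toℕ j
toℕ-suc≡inject₁ {j = j} eq = trans (cong toℕ eq) (toℕ-inject₁ j)

Consecutive-irrefl : ∀ {k} {i : Fin k} → ¬ Consecutive i i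
Consecutive-irrefl (inj₁ eq) = ℕ.1+n≢n (toℕ-suc≡inject₁ eq)
Consecutive-irrefl (inj₂ eq) = ℕ.1+n≢n (toℕ-suc≡inject₁ (sym eq))

Consecutive-asym : ∀ {k} {i j : Fin k} → suc i ≡ inject₁ j → suc j ≢ inject₁ i
Consecutive-asym i→j j→i =
  ℕ.<-asym (ℕ.≤-reflexive (toℕ-suc≡inject₁ i→j)) (ℕ.≤-reflexive (toℕ-suc≡inject₁ j→i))

-- The edges 3j, 3j+1 of a path on 3 + t vertices, together with the last two edges.
dominatingPathEdges : (t : ℕ) → List (Fin (2 + t))
laterEdges : (t : ℕ) → List (Fin (2 + t))

dominatingPathEdges t = zero ∷ suc zero ∷ laterEdges t

laterEdges 0 = []
laterEdges 1 = suc (suc zero) ∷ []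
laterEdges 2 = suc (suc zero) ∷ suc (suc (suc zero)) ∷ []
laterEdges (ℕ.suc (ℕ.suc (ℕ.suc t))) = map (3 ↑ʳ_) (dominatingPathEdges t)

dominatingPathEdges-unique : ∀ t → Unique (dominatingPathEdges t)
dominatingPathEdges-unique 0 = from-yes (DecUnique.unique? _≟_ (dominatingPathEdges 0))
dominatingPathEdges-unique 1 = from-yes (DecUnique.unique? _≟_ (dominatingPathEdges 1))
dominatingPathEdges-unique 2 = from-yes (DecUnique.unique? _≟_ (dominatingPathEdges 2))
dominatingPathEdges-unique (ℕ.suc (ℕ.suc (ℕ.suc t))) =
  ((λ ()) ∷ fresh (λ ())) ∷ fresh (λ ()) ∷ Unique.map⁺ (↑ʳ-injective 3 _ _) (dominatingPathEdges-unique t)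
  where
    fresh : ∀ {i} → (∀ {j} → i ≢ 3 ↑ʳ j) → All (i ≢_) (map (3 ↑ʳ_) (dominatingPathEdges t))
    fresh i≢ = All.map⁺ (universal (λ _ → i≢) _)

length-dominatingPathEdges : ∀ t → length (dominatingPathEdges t) ≡ (2 * (3 + t) + 2) / 3
length-dominatingPathEdges 0 = refl
length-dominatingPathEdges 1 = refl
length-dominatingPathEdges 2 = refl
length-dominatingPathEdges (ℕ.suc (ℕ.suc (ℕ.suc t))) = begin
  2 + length (map (3 ↑ʳ_) (dominatingPathEdges t))  ≡⟨ cong (2 +_) (length-map _ (dominatingPathEdges t)) ⟩
  2 + length (dominatingPathEdges t)                ≡⟨ cong (2 +_) (length-dominatingPathEdges t) ⟩
  2 + (2 * (3 + t) + 2) / 3                         ≡⟨ ℕ.+-comm 2 _ ⟩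
  (2 * (3 + t) + 2) / 3 + 2 * 3 / 3                 ≡⟨ +-distrib-/-∣ʳ (2 * (3 + t) + 2) {d = 3} (divides-refl 2) ⟨
  (2 * (3 + t) + 2 + 2 * 3) / 3                     ≡⟨ cong (_/ 3) (shift t) ⟩
  (2 * (6 + t) + 2) / 3                             ∎
  where
    open ≡-Reasoning
    shift : ∀ t → 2 * (3 + t) + 2 + 2 * 3 ≡ 2 * (6 + t) + 2
    shift = solve-∀

dominatingPathEdges-cover : ∀ t (j : Fin (3 + t)) →
                            ∃[ i ] (i ∈ dominatingPathEdges t × (inject₁ i ≡ j ⊎ suc i ≡ j))
dominatingPathEdges-cover _ zero = zero , here refl , inj₁ refl
dominatingPathEdges-cover _ (suc zero) = zero , here refl , inj₂ refl
dominatingPathEdges-cover _ (suc (suc zero)) = suc zero , there (here refl) , inj₂ refl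
dominatingPathEdges-cover 0 (suc (suc (suc ())))
dominatingPathEdges-cover 1 (suc (suc (suc zero))) = suc (suc zero) , there (there (here refl)) , inj₂ refl
dominatingPathEdges-cover 2 (suc (suc (suc zero))) = suc (suc zero) , there (there (here refl)) , inj₂ refl
dominatingPathEdges-cover 2 (suc (suc (suc (suc zero)))) =
  suc (suc (suc zero)) , there (there (there (here refl))) , inj₂ refl
dominatingPathEdges-cover (ℕ.suc (ℕ.suc (ℕ.suc t))) (suc (suc (suc j))) with dominatingPathEdges-cover t j
... | i , i∈ , i~j = 3 ↑ʳ i , there (there (∈-map⁺ (3 ↑ʳ_) i∈)) , Sum.map (cong (3 ↑ʳ_)) (cong (3 ↑ʳ_)) i~j

dominatingPathEdges-paired : ∀ t {i} → i ∈ dominatingPathEdges t →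
                             ∃[ j ] (j ∈ dominatingPathEdges t × Consecutive i j)
dominatingPathEdges-paired _ (here refl) = suc zero , there (here refl) , inj₁ refl
dominatingPathEdges-paired _ (there (here refl)) = zero , here refl , inj₂ refl
dominatingPathEdges-paired 1 (there (there (here refl))) = suc zero , there (here refl) , inj₂ refl
dominatingPathEdges-paired 2 (there (there (here refl))) = suc zero , there (here refl) , inj₂ refl
dominatingPathEdges-paired 2 (there (there (there (here refl)))) =
  suc (suc zero) , there (there (here refl)) , inj₂ refl
dominatingPathEdges-paired (ℕ.suc (ℕ.suc (ℕ.suc t))) (there (there i∈)) with ∈-map⁻ (3 ↑ʳ_) i∈
... | i , i∈′ , refl with dominatingPathEdges-paired t i∈′
...   | j , j∈ , i~j = 3 ↑ʳ j , there (there (∈-map⁺ (3 ↑ʳ_) j∈)) , Sum.map (cong (3 ↑ʳ_)) (cong (3 ↑ʳ_)) i~j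

module SpanningPathDomination {t : ℕ} (A : AdjMat (3 + t)) (simple : IsSimple A)
  (v : Fin (3 + t) → Fin (3 + t)) (v-injective : Injective _≡_ _≡_ v)
  (v-adjacent : ∀ i j → toℕ j ≡ ℕ.suc (toℕ i) → A (v i) (v j) ≡ true) where

  pathEdgeJoins : ∀ i → ∃[ e ] Joins e (v (inject₁ i)) (v (suc i))
  pathEdgeJoins i = edgeBetween simple (v-adjacent (inject₁ i) (suc i) (cong ℕ.suc (sym (toℕ-inject₁ i))))

  pathEdge : Fin (2 + t) → Edge A
  pathEdge i = proj₁ (pathEdgeJoins i)

  pathEdge-incident : ∀ {i j} → inject₁ i ≡ j ⊎ suc i ≡ j → IsEnd (v j) (pathEdge i)
  pathEdge-incident {i} (inj₁ refl) = Joins.first (proj₂ (pathEdgeJoins i))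
  pathEdge-incident {i} (inj₂ refl) = Joins.second (proj₂ (pathEdgeJoins i))

  pathEdge-second : ∀ {i j} → pathEdge i ≡ pathEdge j → suc i ≡ inject₁ j ⊎ suc i ≡ suc j
  pathEdge-second {i} {j} eq = Sum.map v-injective v-injective
    (Joins.only (proj₂ (pathEdgeJoins j)) (subst (IsEnd (v (suc i))) eq (pathEdge-incident (inj₂ refl))))

  pathEdge-injective : Injective _≡_ _≡_ pathEdge
  pathEdge-injective eq with pathEdge-second eq | pathEdge-second (sym eq)
  ... | inj₂ si≡sj | _          = suc-injective si≡sj
  ... | _          | inj₂ sj≡si = suc-injective (sym sj≡si)
  ... | inj₁ i→j   | inj₁ j→i   = ⊥-elim (Consecutive-asym i→j j→i)

  consecutive-adjacent : ∀ {i j} → Consecutive i j → MAdj A (inj₂ (pathEdge i)) (inj₂ (pathEdge j))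
  consecutive-adjacent {i} {j} i~j = distinct , shared i~j
    where
      distinct : pathEdge i ≢ pathEdge j
      distinct eq = Consecutive-irrefl (subst (Consecutive i) (sym (pathEdge-injective eq)) i~j)
      shared : Consecutive i j → ∃[ w ] (IsEnd w (pathEdge i) × IsEnd w (pathEdge j))
      shared (inj₁ si≡ij) = v (suc i)     , pathEdge-incident (inj₂ refl) , pathEdge-incident (inj₁ (sym si≡ij))
      shared (inj₂ ii≡sj) = v (inject₁ i) , pathEdge-incident (inj₁ refl) , pathEdge-incident (inj₂ (sym ii≡sj))

  S : List (MVertex A)
  S = map (inj₂ ∘ pathEdge) (dominatingPathEdges t)

  covered : ∀ x → ∃[ i ] (i ∈ dominatingPathEdges t × IsEnd x (pathEdge i))
  covered x with endo-injective⇒surjective v-injective x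
  ... | j , refl with dominatingPathEdges-cover t j
  ...   | i , i∈ , i~j = i , i∈ , pathEdge-incident i~j

  dominates : ∀ y → Any (MAdj A y) S
  dominates (inj₁ x) with covered x
  ... | i , i∈ , x∈ = lose (∈-map⁺ _ i∈) x∈
  dominates (inj₂ e@(a , _)) with covered a
  ... | i , i∈ , a∈ with edge-≟ e (pathEdge i)
  ...   | no e≢ = lose (∈-map⁺ _ i∈) (e≢ , a , inj₁ refl , a∈)
  ...   | yes refl with dominatingPathEdges-paired t i∈
  ...     | j , j∈ , i~j = lose (∈-map⁺ _ j∈) (consecutive-adjacent i~j)

  isTDS : IsTDS (MAdj A) S
  isTDS = Unique.map⁺ (pathEdge-injective ∘ inj₂-injective) (dominatingPathEdges-unique t) , dominates

  length-S : length S ≡ (2 * (3 + t) + 2) / 3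
  length-S = trans (length-map _ (dominatingPathEdges t)) (length-dominatingPathEdges t)

spanningPath⇒middleTDS : ∀ {N} (A : AdjMat N) → IsSimple A → HasSpanningPath A → 3 ≤ N →
                         ∃[ S ] (IsTDS (MAdj A) S × length S ≡ (2 * N + 2) / 3)
spanningPath⇒middleTDS A simple (v , v-injective , v-adjacent) (s≤s (s≤s (s≤s z≤n))) =
  S , isTDS , length-S
  where open SpanningPathDomination A simple v v-injective v-adjacent

module _ {n : ℕ} (G : AdjMat n) (p : ℕ) where

  join-Kbar-isSimple : IsSimple G → IsSimple (join-Kbar G p)
  join-Kbar-isSimple simple = record { sym = symmetric ; irrefl = irreflexive }
    where
      symmetric : ∀ u v → join-Kbar G p u v ≡ true → join-Kbar G p v u ≡ true
      symmetric u v uv with splitAt n u | splitAt n v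
      ... | inj₁ x | inj₁ y = IsSimple.sym simple x y uv
      ... | inj₁ _ | inj₂ _ = refl
      ... | inj₂ _ | inj₁ _ = refl
      ... | inj₂ _ | inj₂ _ = uv
      irreflexive : ∀ u → join-Kbar G p u u ≡ false
      irreflexive u with splitAt n u
      ... | inj₁ x = IsSimple.irrefl simple x
      ... | inj₂ _ = refl

  join-Kbar-↑ˡ↑ˡ : ∀ x y → join-Kbar G p (x ↑ˡ p) (y ↑ˡ p) ≡ G x y
  join-Kbar-↑ˡ↑ˡ x y rewrite splitAt-↑ˡ n x p | splitAt-↑ˡ n y p = refl

  join-Kbar-↑ˡ↑ʳ : ∀ x y → join-Kbar G p (x ↑ˡ p) (n ↑ʳ y) ≡ true
  join-Kbar-↑ˡ↑ʳ x y rewrite splitAt-↑ˡ n x p | splitAt-↑ʳ n p y = refl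

  join-Kbar-↑ʳ↑ˡ : ∀ x y → join-Kbar G p (n ↑ʳ y) (x ↑ˡ p) ≡ true
  join-Kbar-↑ʳ↑ˡ x y rewrite splitAt-↑ˡ n x p | splitAt-↑ʳ n p y = refl

-- A spanning path of G + K̄_p: positions 0 … p-1 of a spanning path of G alternate with the
-- p new vertices, followed by the rest of that path. An entry inj₁ a of the woven sequence
-- is a position a on the path of G, an entry inj₂ b is the new vertex b.
weaveLength : ℕ → ℕ → ℕ
weaveLength ℕ.zero    r = r
weaveLength (ℕ.suc p) r = ℕ.suc (ℕ.suc (weaveLength p r))

weave : ∀ p r → Fin (weaveLength p r) → Fin (p + r) ⊎ Fin p
weave ℕ.zero    r i             = inj₁ i
weave (ℕ.suc p) r zero          = inj₁ zero
weave (ℕ.suc p) r (suc zero)    = inj₂ zero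
weave (ℕ.suc p) r (suc (suc i)) = Sum.map suc suc (weave p r i)

weaveLength≡ : ∀ p r → (p + r) + p ≡ weaveLength p r
weaveLength≡ ℕ.zero    r = ℕ.+-identityʳ r
weaveLength≡ (ℕ.suc p) r = cong ℕ.suc (trans (ℕ.+-suc (p + r) p) (cong ℕ.suc (weaveLength≡ p r)))

WeaveStep : ∀ {a b} → Fin a ⊎ Fin b → Fin a ⊎ Fin b → Set
WeaveStep (inj₁ x) (inj₁ y) = toℕ y ≡ ℕ.suc (toℕ x)
WeaveStep (inj₁ _) (inj₂ _) = ⊤
WeaveStep (inj₂ _) (inj₁ _) = ⊤
WeaveStep (inj₂ _) (inj₂ _) = ⊥

WeaveStep-map-suc : ∀ {a b} {x y : Fin a ⊎ Fin b} →
                    WeaveStep x y → WeaveStep (Sum.map suc suc x) (Sum.map suc suc y)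
WeaveStep-map-suc {x = inj₁ _} {inj₁ _} step = cong ℕ.suc step
WeaveStep-map-suc {x = inj₁ _} {inj₂ _} step = step
WeaveStep-map-suc {x = inj₂ _} {inj₁ _} step = step

weave-start : ∀ p r (i : Fin (weaveLength p r)) → toℕ i ≡ 0 → ∃[ x ] weave p r i ≡ inj₁ x
weave-start ℕ.zero    r i    _ = i , refl
weave-start (ℕ.suc p) r zero _ = zero , refl

weave-step : ∀ p r (i j : Fin (weaveLength p r)) → toℕ j ≡ ℕ.suc (toℕ i) →
             WeaveStep (weave p r i) (weave p r j)
weave-step ℕ.zero    r i             j             j≡1+i = j≡1+i
weave-step (ℕ.suc p) r zero          (suc zero)    _     = tt
weave-step (ℕ.suc p) r (suc zero)    (suc (suc j)) j≡1+i
  rewrite proj₂ (weave-start p r j (ℕ.suc-injective (ℕ.suc-injective j≡1+i))) = tt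
weave-step (ℕ.suc p) r (suc (suc i)) (suc (suc j)) j≡1+i =
  WeaveStep-map-suc (weave-step p r i j (ℕ.suc-injective (ℕ.suc-injective j≡1+i)))

map-suc≢inj₁-zero : ∀ {a b} (x : Fin a ⊎ Fin b) → Sum.map suc suc x ≢ inj₁ zero
map-suc≢inj₁-zero (inj₁ _) ()
map-suc≢inj₁-zero (inj₂ _) ()

map-suc≢inj₂-zero : ∀ {a b} (x : Fin a ⊎ Fin b) → Sum.map suc suc x ≢ inj₂ zero
map-suc≢inj₂-zero (inj₁ _) ()
map-suc≢inj₂-zero (inj₂ _) ()

map-suc-injective : ∀ {a b} {x y : Fin a ⊎ Fin b} → Sum.map suc suc x ≡ Sum.map suc suc y → x ≡ y
map-suc-injective {x = inj₁ _} {inj₁ _} refl = refl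
map-suc-injective {x = inj₂ _} {inj₂ _} refl = refl

weave-injective : ∀ p r → Injective _≡_ _≡_ (weave p r)
weave-injective ℕ.zero    r eq = inj₁-injective eq
weave-injective (ℕ.suc p) r {zero}        {zero}        _  = refl
weave-injective (ℕ.suc p) r {suc zero}    {suc zero}    _  = refl
weave-injective (ℕ.suc p) r {suc (suc i)} {suc (suc j)} eq =
  cong (suc ∘ suc) (weave-injective p r (map-suc-injective eq))
weave-injective (ℕ.suc p) r {zero}        {suc zero}    ()
weave-injective (ℕ.suc p) r {suc zero}    {zero}        ()
weave-injective (ℕ.suc p) r {zero}        {suc (suc j)} eq = ⊥-elim (map-suc≢inj₁-zero (weave p r j) (sym eq))
weave-injective (ℕ.suc p) r {suc (suc i)} {zero}        eq = ⊥-elim (map-suc≢inj₁-zero (weave p r i) eq)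
weave-injective (ℕ.suc p) r {suc zero}    {suc (suc j)} eq = ⊥-elim (map-suc≢inj₂-zero (weave p r j) (sym eq))
weave-injective (ℕ.suc p) r {suc (suc i)} {suc zero}    eq = ⊥-elim (map-suc≢inj₂-zero (weave p r i) eq)

join-Kbar-spanningPath : ∀ {n} (G : AdjMat n) p → p ≤ n →
                         HasSpanningPath G → HasSpanningPath (join-Kbar G p)
join-Kbar-spanningPath G p p≤n (f , f-injective , f-adjacent) with ℕ.m≤n⇒∃[o]m+o≡n p≤n
... | r , refl = place ∘ weave p r ∘ reindex ,
                 reindex-injective ∘ weave-injective p r ∘ place-injective ,
                 λ i j j≡1+i → place-step (weave-step p r (reindex i) (reindex j) (reindex-step j≡1+i))
  where
    reindex : Fin ((p + r) + p) → Fin (weaveLength p r)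
    reindex = cast (weaveLength≡ p r)

    reindex-injective : Injective _≡_ _≡_ reindex
    reindex-injective {i} {j} eq =
      toℕ-injective (trans (sym (toℕ-cast _ i)) (trans (cong toℕ eq) (toℕ-cast _ j)))

    reindex-step : ∀ {i j} → toℕ j ≡ ℕ.suc (toℕ i) → toℕ (reindex j) ≡ ℕ.suc (toℕ (reindex i))
    reindex-step {i} {j} j≡1+i = trans (toℕ-cast _ j) (trans j≡1+i (cong ℕ.suc (sym (toℕ-cast _ i))))

    place : Fin (p + r) ⊎ Fin p → Fin ((p + r) + p)
    place = join (p + r) p ∘ Sum.map₁ f

    place-injective : Injective _≡_ _≡_ place
    place-injective eq = map₁-injective
      (trans (sym (splitAt-join (p + r) p _)) (trans (cong (splitAt (p + r)) eq) (splitAt-join (p + r) p _)))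
      where
        map₁-injective : ∀ {x y} → Sum.map₁ f x ≡ Sum.map₁ f y → x ≡ y
        map₁-injective {inj₁ _} {inj₁ _} = cong inj₁ ∘ f-injective ∘ inj₁-injective
        map₁-injective {inj₂ _} {inj₂ _} = cong inj₂ ∘ inj₂-injective
        map₁-injective {inj₁ _} {inj₂ _} ()
        map₁-injective {inj₂ _} {inj₁ _} ()

    place-step : ∀ {x y} → WeaveStep x y → join-Kbar G p (place x) (place y) ≡ true
    place-step {inj₁ a} {inj₁ b} b≡1+a = trans (join-Kbar-↑ˡ↑ˡ G p (f a) (f b)) (f-adjacent a b b≡1+a)
    place-step {inj₁ a} {inj₂ b} _ = join-Kbar-↑ˡ↑ʳ G p (f a) b
    place-step {inj₂ b} {inj₁ a} _ = join-Kbar-↑ʳ↑ˡ G p (f a) b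

proposition4p16 : (n p : ℕ) (G : AdjMat n) → IsSimple G → 2 ≤ n → 1 ≤ p → 2 * p + 2 ≤ n →
    HasSpanningPath G →
    TotalDominationNumber (MAdj (join-Kbar G p)) ((2 * (n + p) + 2) / 3)
proposition4p16 n p G simple 2≤n 1≤p 2p+2≤n path =
  spanningPath⇒middleTDS (join-Kbar G p) (join-Kbar-isSimple G p simple)
                         (join-Kbar-spanningPath G p p≤n path) (ℕ.+-mono-≤ 2≤n 1≤p) ,
  length-middleTDS-≥ (join-Kbar G p)
  where
    p≤n : p ≤ n
    p≤n = ℕ.≤-trans (ℕ.m≤m+n p (p + 0)) (ℕ.≤-trans (ℕ.m≤m+n (2 * p) 2) 2p+2≤n)
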